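{- Let $G$ be a finite group, $H$ a subgroup of $G$, and $S\subset G$ a subset such that $S\cap H$ is symmetric. In the group-subgroup pair graph $\mathcal{G}(G,H,S)$, all vertices in the same right coset of $H$ have the same degree. Namely, every vertex in $H$ has degree $|S|$, and for $x\notin H$ every vertex of the coset $Hx$ has degree $|S\cap Hx|$.
   Context: A subset $X\subset G$ is symmetric if $X^{ -1}=X$. Write $S_H=S\cap H$ and $S_O=S\setminus H$. The group-subgroup pair graph $\mathcal{G}(G,H,S)$ is the undirected graph with vertex set $G$ whose edges are exactly the pairs $\{h,hs\}$ with $h\in H$ and $s\in S$ (for $s\in S_H$ the edge joins two elements of $H$; for $s\in S_O$ it joins $h\in H$ to $hs\in G\setminus H$). Cosets are right cosets $Hx$. -}

module Defs where

open import Data.Nat using (ℕ)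
open import Level using (0ℓ)
open import Data.Fin using (Fin; _≟_)
open import Data.Fin.Properties using (any?)
open import Data.Fin.Subset using (Subset; _∈_; _∉_)
open import Data.Fin.Subset.Properties using (_∈?_)
open import Data.Vec.Base using (count; allFin)
open import Data.Product using (∃; _×_; _,_)
open import Data.Sum using (_⊎_)
open import Relation.Binary.PropositionalEquality using (_≡_)
open import Relation.Nullary using (Dec)
open import Relation.Nullary.Decidable using (_×-dec_; _⊎-dec_)
open import Relation.Unary using (Pred; Decidable)
open import Algebra.Core using (Op₁; Op₂)

-- A finite group is modelled as a group structure (w.r.t. ≡) on Fin n.
-- H is a subgroup of (Fin n, _∙_, ε, _⁻¹), given as a subset closed under
-- the identity, products and inverses.
record IsSubgroup {n : ℕ} (_∙_ : Op₂ (Fin n)) (ε : Fin n) (_⁻¹ : Op₁ (Fin n))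
                  (H : Subset n) : Set where
  field
    ε∈H  : ε ∈ H
    ∙∈H  : ∀ {a b} → a ∈ H → b ∈ H → (a ∙ b) ∈ H
    ⁻¹∈H : ∀ {a} → a ∈ H → (a ⁻¹) ∈ H

-- X is symmetric: X⁻¹ = X  (for an involutive inverse this is X⁻¹ ⊆ X)
Symmetric : {n : ℕ} (_⁻¹ : Op₁ (Fin n)) (X : Pred (Fin n) 0ℓ) → Set
Symmetric _⁻¹ X = ∀ {a} → X a → X (a ⁻¹) 

card : {n : ℕ} {P : Pred (Fin n) 0ℓ} → Decidable P → ℕ
card {n} P? = count P? (allFin n)

InRightCoset : {n : ℕ} (_∙_ : Op₂ (Fin n)) (H : Subset n) (x y : Fin n) → Set
InRightCoset _∙_ H x y = ∃ λ h → h ∈ H × y ≡ h ∙ x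

inRightCoset? : {n : ℕ} (_∙_ : Op₂ (Fin n)) (H : Subset n) (x : Fin n) →
                Decidable (InRightCoset _∙_ H x)
inRightCoset? _∙_ H x y = any? (λ h → (h ∈? H) ×-dec (y ≟ (h ∙ x)))

EdgeFrom : {n : ℕ} (_∙_ : Op₂ (Fin n)) (H S : Subset n) (u v : Fin n) → Set
EdgeFrom _∙_ H S u v = u ∈ H × ∃ λ s → s ∈ S × v ≡ u ∙ s

edgeFrom? : {n : ℕ} (_∙_ : Op₂ (Fin n)) (H S : Subset n) (u v : Fin n) →
            Dec (EdgeFrom _∙_ H S u v)
edgeFrom? _∙_ H S u v = (u ∈? H) ×-dec any? (λ s → (s ∈? S) ×-dec (v ≟ (u ∙ s)))

-- Adjacency in the undirected group-subgroup pair graph 𝒢(G,H,S):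
-- {v , w} is an edge iff it is of the form {h , h ∙ s}.
Adj : {n : ℕ} (_∙_ : Op₂ (Fin n)) (H S : Subset n) (v w : Fin n) → Set
Adj _∙_ H S v w = EdgeFrom _∙_ H S v w ⊎ EdgeFrom _∙_ H S w v

adj? : {n : ℕ} (_∙_ : Op₂ (Fin n)) (H S : Subset n) (v : Fin n) →
       Decidable (Adj _∙_ H S v)
adj? _∙_ H S v w = edgeFrom? _∙_ H S v w ⊎-dec edgeFrom? _∙_ H S w v

-- Degree of v: the number of vertices adjacent to v (a loop counts once)
degree : {n : ℕ} (_∙_ : Op₂ (Fin n)) (H S : Subset n) (v : Fin n) → ℕ
degree _∙_ H S v = card (adj? _∙_ H S v)

cardSCoset : {n : ℕ} (_∙_ : Op₂ (Fin n)) (H S : Subset n) (x : Fin n) → ℕ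
cardSCoset _∙_ H S x = card (λ y → (y ∈? S) ×-dec inRightCoset? _∙_ H x y)

-- A vertex h ∈ H is joined to w exactly when h⁻¹w ∈ S: edges {h, hs} give this
-- directly, and an edge {w, ws} with w ∈ H, s ∈ S forces s ∈ S ∩ H, so
-- h⁻¹w = s⁻¹ ∈ S by symmetry. A vertex v ∉ H only meets edges {w, ws} with
-- w ∈ H, so its neighbours are the w with w⁻¹v ∈ S, and w ∈ H iff w⁻¹v ∈ Hx.
-- In both cases w ↦ h⁻¹w resp. w ↦ w⁻¹v is a bijection of G carrying the
-- neighbourhood onto S resp. S ∩ Hx. Equal degrees along a coset follow, since
-- Hx is either H or disjoint from it.
module Submission where

open import Defs
open import Data.Nat using (ℕ; zero; suc)
open import Data.Nat.Properties using (+-0-commutativeMonoid)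
open import Data.Bool.Base using (true; false; if_then_else_)
open import Data.Bool.Properties using (_≟_)
open import Data.Fin using (Fin)
open import Data.Fin.Subset using (Subset; _∈_; _∉_; ∣_∣; inside)
open import Data.Fin.Subset.Properties using (_∈?_)
open import Data.Fin.Permutation using (Permutation′; permutation; _⟨$⟩ʳ_)
open import Data.Vec.Base using (count; tabulate; lookup)
open import Data.Vec.Properties using (tabulate∘lookup; []=⇒lookup; lookup⇒[]=)
open import Data.Product using (_×_; _,_; proj₁)
open import Data.Product.Function.NonDependent.Propositional using (_×-⇔_)
open import Data.Sum using (inj₁; inj₂)
open import Data.Empty using (⊥-elim)
open import Function using (_∘_; id)
open import Function.Bundles using (_⇔_; mk⇔; Equivalence)
open import Function.Construct.Composition using (_⇔-∘_)
open import Function.Construct.Identity using (⇔-id)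
open import Function.Construct.Symmetry using (⇔-sym)
open import Level using (0ℓ)
open import Relation.Binary.PropositionalEquality
open import Relation.Nullary using (does; yes; no)
open import Relation.Nullary.Decidable using (does-⇔; _×-dec_)
open import Relation.Unary using (Pred; Decidable)
open import Algebra.Core using (Op₁; Op₂)
open import Algebra.Structures using (IsGroup)
open import Algebra.Bundles using (Group)
open import Algebra.Properties.CommutativeMonoid.Sum +-0-commutativeMonoid
  using (sum; sum-permute; sum-cong-≗)
import Algebra.Properties.Group as GroupProperties

indicator : {A : Set} {P : Pred A 0ℓ} → Decidable P → A → ℕ
indicator P? x = if does (P? x) then 1 else 0

indicator-⇔ : {A B : Set} {P : Pred A 0ℓ} {Q : Pred B 0ℓ}
  (P? : Decidable P) (Q? : Decidable Q) {x : A} {y : B} →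
  P x ⇔ Q y → indicator P? x ≡ indicator Q? y
indicator-⇔ P? Q? {x} {y} Px⇔Qy =
  cong (if_then 1 else 0) (does-⇔ Px⇔Qy (P? x) (Q? y))

count-tabulate : {A : Set} {P : Pred A 0ℓ} (P? : Decidable P) {m : ℕ} (f : Fin m → A) →
  count P? (tabulate f) ≡ sum (indicator P? ∘ f)
count-tabulate P? {zero} f = refl
count-tabulate P? {suc m} f with does (P? (f Fin.zero))
... | true  = cong suc (count-tabulate P? (f ∘ Fin.suc))
... | false = count-tabulate P? (f ∘ Fin.suc)

card-permute : {n : ℕ} {P Q : Pred (Fin n) 0ℓ} (P? : Decidable P) (Q? : Decidable Q)
  (π : Permutation′ n) → (∀ x → P x ⇔ Q (π ⟨$⟩ʳ x)) → card P? ≡ card Q?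
card-permute P? Q? π P⇔Q∘π = begin
  card P?                          ≡⟨ count-tabulate P? id ⟩
  sum (indicator P?)               ≡⟨ sum-cong-≗ (λ x → indicator-⇔ P? Q? (P⇔Q∘π x)) ⟩
  sum (indicator Q? ∘ (π ⟨$⟩ʳ_))  ≡⟨ sum-permute (indicator Q?) π ⟨
  sum (indicator Q?)               ≡⟨ count-tabulate Q? id ⟨
  card Q?                          ∎
  where open ≡-Reasoning

card-∈? : {n : ℕ} (S : Subset n) → card (_∈? S) ≡ ∣ S ∣
card-∈? S = begin
  card (_∈? S)
    ≡⟨ count-tabulate (_∈? S) id ⟩
  sum (indicator (_∈? S))
    ≡⟨ sum-cong-≗ (λ x → indicator-⇔ (_∈? S) (_≟ inside) (∈⇔lookup x)) ⟩
  sum (indicator (_≟ inside) ∘ lookup S)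
    ≡⟨ count-tabulate (_≟ inside) (lookup S) ⟨
  count (_≟ inside) (tabulate (lookup S))
    ≡⟨ cong (count (_≟ inside)) (tabulate∘lookup S) ⟩
  ∣ S ∣ ∎
  where
  open ≡-Reasoning
  ∈⇔lookup : ∀ x → x ∈ S ⇔ lookup S x ≡ inside
  ∈⇔lookup x = mk⇔ []=⇒lookup (lookup⇒[]= x S)

module PairGraph {n : ℕ} {mul : Op₂ (Fin n)} {one : Fin n} {inv : Op₁ (Fin n)}
  (isGroup : IsGroup _≡_ mul one inv)
  {H : Subset n} (isSubgroup : IsSubgroup mul one inv H) (S : Subset n) where

  group : Group 0ℓ 0ℓ
  group = record { isGroup = isGroup }

  open Group group using (_∙_; _⁻¹; _\\_; _//_; assoc)
  open IsSubgroup isSubgroup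

  open GroupProperties group
    using (\\-leftDividesˡ; \\-leftDividesʳ; //-rightDividesˡ; //-rightDividesʳ;
           ⁻¹-anti-homo-\\; ⁻¹-anti-homo-//)

  \\∈H : ∀ {a b} → a ∈ H → b ∈ H → a \\ b ∈ H
  \\∈H a∈H b∈H = ∙∈H (⁻¹∈H a∈H) b∈H

  \\∈H⇔∈H : ∀ {k w} → k ∈ H → (w \\ k ∈ H ⇔ w ∈ H)
  \\∈H⇔∈H {k} {w} k∈H = mk⇔ from-quotient (λ w∈H → \\∈H w∈H k∈H)
    where
    from-quotient : w \\ k ∈ H → w ∈ H
    from-quotient p = subst (_∈ H) k∙[w\\k]⁻¹≡w (∙∈H k∈H (⁻¹∈H p))
      where
      k∙[w\\k]⁻¹≡w : k ∙ (w \\ k) ⁻¹ ≡ w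
      k∙[w\\k]⁻¹≡w = trans (cong (k ∙_) (⁻¹-anti-homo-\\ w k)) (\\-leftDividesˡ k w)

  ∈Hx⇔//∈H : ∀ {x y} → InRightCoset _∙_ H x y ⇔ y // x ∈ H
  ∈Hx⇔//∈H {x} {y} = mk⇔ to (λ p → y // x , p , sym (//-rightDividesˡ x y))
    where
    to : InRightCoset _∙_ H x y → y // x ∈ H
    to (h , h∈H , refl) = subst (_∈ H) (sym (//-rightDividesʳ x h)) h∈H

  \\∈Hx⇔∈H : ∀ {x v w} → InRightCoset _∙_ H x v → (InRightCoset _∙_ H x (w \\ v) ⇔ w ∈ H)
  \\∈Hx⇔∈H {x} {v} {w} v∈Hx =
    subst (λ z → z ∈ H ⇔ w ∈ H) (sym (assoc (w ⁻¹) v (x ⁻¹)))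
      (\\∈H⇔∈H (Equivalence.to ∈Hx⇔//∈H v∈Hx))
    ⇔-∘ ∈Hx⇔//∈H

  adj⇔\\∈S : Symmetric _⁻¹ (λ a → a ∈ S × a ∈ H) →
    ∀ {h w} → h ∈ H → Adj _∙_ H S h w ⇔ h \\ w ∈ S
  adj⇔\\∈S symmetric {h} {w} h∈H =
    mk⇔ to (λ p → inj₁ (h∈H , h \\ w , p , sym (\\-leftDividesˡ h w)))
    where
    to : Adj _∙_ H S h w → h \\ w ∈ S
    to (inj₁ (_ , s , s∈S , refl)) = subst (_∈ S) (sym (\\-leftDividesʳ h s)) s∈S
    to (inj₂ (w∈H , s , s∈S , refl)) =
      subst (_∈ S) (sym [ws]\\w≡s⁻¹) (proj₁ (symmetric (s∈S , s∈H)))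
      where
      s∈H : s ∈ H
      s∈H = subst (_∈ H) (\\-leftDividesʳ w s) (\\∈H w∈H h∈H)
      [ws]\\w≡s⁻¹ : (w ∙ s) \\ w ≡ s ⁻¹
      [ws]\\w≡s⁻¹ = trans (sym (⁻¹-anti-homo-\\ w (w ∙ s))) (cong _⁻¹ (\\-leftDividesʳ w s))

  adj⇔\\∈S×∈H : ∀ {v w} → v ∉ H → Adj _∙_ H S v w ⇔ (w \\ v ∈ S × w ∈ H)
  adj⇔\\∈S×∈H {v} {w} v∉H =
    mk⇔ to (λ (p , w∈H) → inj₂ (w∈H , w \\ v , p , sym (\\-leftDividesˡ w v)))
    where
    to : Adj _∙_ H S v w → w \\ v ∈ S × w ∈ H
    to (inj₁ (v∈H , _)) = ⊥-elim (v∉H v∈H)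
    to (inj₂ (w∈H , s , s∈S , refl)) = subst (_∈ S) (sym (\\-leftDividesʳ w s)) s∈S , w∈H

  ∉H-coset : ∀ {x v} → x ∉ H → InRightCoset _∙_ H x v → v ∉ H
  ∉H-coset {x} x∉H (k , k∈H , refl) v∈H =
    x∉H (subst (_∈ H) (\\-leftDividesʳ k x) (\\∈H k∈H v∈H))

  ∈H-coset : ∀ {x v} → x ∈ H → InRightCoset _∙_ H x v → v ∈ H
  ∈H-coset x∈H (k , k∈H , refl) = ∙∈H k∈H x∈H

  degree-∈H : Symmetric _⁻¹ (λ a → a ∈ S × a ∈ H) →
    ∀ h → h ∈ H → degree _∙_ H S h ≡ ∣ S ∣
  degree-∈H symmetric h h∈H = trans
    (card-permute (adj? _∙_ H S h) (_∈? S)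
      (permutation (h \\_) (h ∙_) (\\-leftDividesʳ h) (\\-leftDividesˡ h))
      (λ _ → adj⇔\\∈S symmetric h∈H))
    (card-∈? S)

  degree-∉H : ∀ x → x ∉ H → ∀ v → InRightCoset _∙_ H x v →
    degree _∙_ H S v ≡ cardSCoset _∙_ H S x
  degree-∉H x x∉H v v∈Hx = card-permute (adj? _∙_ H S v)
    (λ y → (y ∈? S) ×-dec inRightCoset? _∙_ H x y)
    (permutation (_\\ v) (v //_) [v//s]\\v≡s v//[w\\v]≡w)
    (λ _ → (⇔-id _ ×-⇔ ⇔-sym (\\∈Hx⇔∈H v∈Hx)) ⇔-∘ adj⇔\\∈S×∈H (∉H-coset x∉H v∈Hx))
    where
    [v//s]\\v≡s : ∀ s → (v // s) \\ v ≡ s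
    [v//s]\\v≡s s = trans (cong (_∙ v) (⁻¹-anti-homo-// v s)) (//-rightDividesˡ v s)
    v//[w\\v]≡w : ∀ w → v // (w \\ v) ≡ w
    v//[w\\v]≡w w = trans (cong (v ∙_) (⁻¹-anti-homo-\\ w v)) (\\-leftDividesˡ v w)

  degree-coset-invariant : Symmetric _⁻¹ (λ a → a ∈ S × a ∈ H) →
    ∀ x v w → InRightCoset _∙_ H x v → InRightCoset _∙_ H x w →
    degree _∙_ H S v ≡ degree _∙_ H S w
  degree-coset-invariant symmetric x v w v∈Hx w∈Hx with x ∈? H
  ... | yes x∈H = trans (degree-∈H symmetric v (∈H-coset x∈H v∈Hx))
                        (sym (degree-∈H symmetric w (∈H-coset x∈H w∈Hx)))
  ... | no  x∉H = trans (degree-∉H x x∉H v v∈Hx) (sym (degree-∉H x x∉H w w∈Hx))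

proposition2p10 : (n : ℕ) (_∙_ : Op₂ (Fin n)) (ε : Fin n) (_⁻¹ : Op₁ (Fin n)) →
    IsGroup _≡_ _∙_ ε _⁻¹ →
    (H : Subset n) → IsSubgroup _∙_ ε _⁻¹ H →
    (S : Subset n) → Symmetric _⁻¹ (λ a → a ∈ S × a ∈ H) →
    ((x v w : Fin n) → InRightCoset _∙_ H x v → InRightCoset _∙_ H x w →
       degree _∙_ H S v ≡ degree _∙_ H S w)
    × ((h : Fin n) → h ∈ H → degree _∙_ H S h ≡ ∣ S ∣)
    × ((x : Fin n) → x ∉ H → (v : Fin n) → InRightCoset _∙_ H x v →
       degree _∙_ H S v ≡ cardSCoset _∙_ H S x)
proposition2p10 n _∙_ ε _⁻¹ isGroup H isSubgroup S symmetric =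
  degree-coset-invariant symmetric , degree-∈H symmetric , degree-∉H
  where open PairGraph isGroup isSubgroup S
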